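{- Let $m \ge 2$ and $n \ge 1$ be integers, $G = C_m \oplus C_{mn}$, and let $R$ be a commutative ring. Let $g_1 \cdot \ldots \cdot g_l$ be a sequence over $G$ and $a_1,\dots,a_l \in R \setminus\{0\}$ such that $(X^{g_1}-a_1)\cdots(X^{g_l}-a_l) = 0$ in $R[G]$. Then for all $k_1,\dots,k_l \in \mathbb N$ (positive integers), also $(X^{k_1g_1}-a_1^{k_1})\cdots(X^{k_lg_l}-a_l^{k_l}) = 0$ in $R[G]$.
   Context: $C_k$ denotes a cyclic group of order $k$, written additively. A sequence over $G$ is a finite unordered list of elements of $G$. For a commutative ring $R$ with $1\neq 0$, $R[G]$ is the group algebra, a free $R$-module with basis $\{X^g : g\in G\}$ and multiplication $X^gX^h = X^{g+h}$, with $R$ embedded via $a \mapsto aX^0$. -}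

module Defs where

open import Level using (Level)
open import Data.Nat as ℕ using (ℕ; zero; suc; NonZero)
open import Data.Nat.DivMod using (_mod_)
open import Data.Fin as Fin using (Fin; toℕ)
open import Data.Fin.Properties using () renaming (_≟_ to _≟ᶠ_)
open import Data.Product using (_×_; _,_)
open import Data.Product.Properties using (≡-dec)
open import Relation.Nullary using (yes; no)
open import Relation.Binary.PropositionalEquality using (_≡_)
open import Relation.Binary.Definitions using (DecidableEquality)
open import Algebra.Bundles using (CommutativeRing)

module _ {k : ℕ} .{{_ : NonZero k}} where
  infixl 6 _+C_
  _+C_ : Fin k → Fin k → Fin k
  a +C b = (toℕ a ℕ.+ toℕ b) mod k

  -C_ : Fin k → Fin k
  -C a = (k ℕ.∸ toℕ a) mod k

  0C : Fin k
  0C = 0 mod k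

module _ (m n : ℕ) .{{_ : NonZero m}} .{{_ : NonZero (m ℕ.* n)}} where
  G : Set
  G = Fin m × Fin (m ℕ.* n)

  infixl 6 _+G_
  _+G_ : G → G → G
  (a , b) +G (c , d) = (a +C c) , (b +C d)

  -G_ : G → G
  -G (a , b) = (-C a) , (-C b)

  0G : G
  0G = 0C , 0C

  _•G_ : ℕ → G → G
  zero •G g = 0G
  suc k •G g = g +G (k •G g)

  _≟G_ : DecidableEquality G
  _≟G_ = ≡-dec _≟ᶠ_ _≟ᶠ_

-- The group algebra R[G]: since G is finite, R[G] ≅ functions G → R,
-- with basis X^g = indicator of g and convolution product.

module GroupAlgebra {c ℓ : Level} (R : CommutativeRing c ℓ)
                    (m n : ℕ) .{{_ : NonZero m}} .{{_ : NonZero (m ℕ.* n)}} where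
  open CommutativeRing R

  sumFin : (j : ℕ) → (Fin j → Carrier) → Carrier
  sumFin zero f = 0#
  sumFin (suc j) f = f Fin.zero + sumFin j (λ i → f (Fin.suc i))

  sumG : (G m n → Carrier) → Carrier
  sumG f = sumFin m (λ i → sumFin (m ℕ.* n) (λ j → f (i , j)))

  RG : Set c
  RG = G m n → Carrier

  mono : Carrier → G m n → RG
  mono a g h with _≟G_ m n h g
  ... | yes _ = a
  ... | no  _ = 0#

  X^_ : G m n → RG
  X^ g = mono 1# g

  emb : Carrier → RG
  emb a = mono a (0G m n)

  0R : RG
  0R _ = 0#

  1R : RG
  1R = X^ (0G m n)

  infixl 6 _-R_
  _-R_ : RG → RG → RG
  (f -R f') h = f h - f' h

  infixl 7 _*R_
  _*R_ : RG → RG → RG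
  (f *R f') h = sumG (λ g → f g * f' (_+G_ m n h (-G_ m n g)))

  prodR : (l : ℕ) → (Fin l → RG) → RG
  prodR zero F = 1R
  prodR (suc l) F = F Fin.zero *R prodR l (λ i → F (Fin.suc i))

  _≈R_ : RG → RG → Set ℓ
  f ≈R f' = ∀ h → f h ≈ f' h

  pow : Carrier → ℕ → Carrier
  pow a zero = 1#
  pow a (suc k) = a * pow a k

module Submission where

-- Lemma 3.1:  if  Π_i (X^{g_i} - a_i) = 0  in R[G], G = C_m ⊕ C_{mn}, then also
-- Π_i (X^{k_i g_i} - a_i^{k_i}) = 0.  The reason is the factorisation
--     X^{kg} - a^k = (X^g - a) · Σ_{j<k} a^{k-1-j} X^{jg},
-- so the second product is the first times a product of cofactors.
--
-- Instead we let elements act as operators on R[G]: X^g - a acts as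
-- f ↦ f(· - g) - a f, the cofactor by a recursion on k.  An operator that is
-- R-linear and commutes with translations ("equivariant") commutes with the
-- cofactor operators, which is all the commutativity the argument needs.

open import Defs
open import Level using (Level; _⊔_)
open import Data.Nat as ℕ using (ℕ; zero; suc; NonZero)
open import Data.Nat.DivMod using (_%_; _mod_; %-distribˡ-+; m%n%n≡m%n; m%n<n; m<n⇒m%n≡m; n%n≡0)
import Data.Nat.Properties as ℕₚ
open import Data.Fin as Fin using (Fin; toℕ)
open import Data.Fin.Properties using (toℕ-fromℕ<; toℕ-injective; toℕ<n; toℕ≤n; punchInᵢ≢i)
open import Data.Vec.Functional using (Vector; removeAt; head; tail)
open import Data.Product using (_,_; proj₁; proj₂)
open import Function using (_∘_)
open import Relation.Binary.PropositionalEquality as ≡ using (_≡_; _≢_; cong; cong₂)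
open import Algebra.Bundles using (AbelianGroup; CommutativeRing)
open import Algebra.Structures using (IsAbelianGroup)
open import Data.Empty using (⊥-elim)
open import Relation.Nullary using (¬_; yes; no)
open import Relation.Binary.Bundles using (Setoid)
import Relation.Binary.Indexed.Heterogeneous.Construct.Trivial as Trivial
open import Function.Indexed.Relation.Binary.Equality using (≡-setoid)

module CyclicGroup {k : ℕ} .{{_ : NonZero k}} where
  open import Data.Nat using (_+_)
  open ≡.≡-Reasoning

  toℕ-mod : ∀ x → toℕ (x mod k) ≡ x % k
  toℕ-mod x = toℕ-fromℕ< (m%n<n x k)

  %-absorbˡ : ∀ x y → (x % k + y) % k ≡ (x + y) % k
  %-absorbˡ x y = begin
    (x % k + y) % k           ≡⟨ %-distribˡ-+ (x % k) y k ⟩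
    (x % k % k + y % k) % k   ≡⟨ cong (λ z → (z + y % k) % k) (m%n%n≡m%n x k) ⟩
    (x % k + y % k) % k       ≡⟨ %-distribˡ-+ x y k ⟨
    (x + y) % k               ∎

  %-absorbʳ : ∀ x y → (x + y % k) % k ≡ (x + y) % k
  %-absorbʳ x y = begin
    (x + y % k) % k  ≡⟨ cong (_% k) (ℕₚ.+-comm x (y % k)) ⟩
    (y % k + x) % k  ≡⟨ %-absorbˡ y x ⟩
    (y + x) % k      ≡⟨ cong (_% k) (ℕₚ.+-comm y x) ⟩
    (x + y) % k      ∎

  toℕ-0C : toℕ (0C {k}) ≡ 0
  toℕ-0C = ≡.trans (toℕ-mod 0) (m<n⇒m%n≡m (ℕ.>-nonZero⁻¹ k))

  +C-assoc : ∀ (a b c : Fin k) → (a +C b) +C c ≡ a +C (b +C c)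
  +C-assoc a b c = toℕ-injective (begin
    toℕ ((a +C b) +C c)                     ≡⟨ toℕ-mod _ ⟩
    (toℕ (a +C b) + toℕ c) % k              ≡⟨ cong (λ z → (z + toℕ c) % k) (toℕ-mod _) ⟩
    ((toℕ a + toℕ b) % k + toℕ c) % k       ≡⟨ %-absorbˡ _ _ ⟩
    (toℕ a + toℕ b + toℕ c) % k             ≡⟨ cong (_% k) (ℕₚ.+-assoc (toℕ a) _ _) ⟩
    (toℕ a + (toℕ b + toℕ c)) % k           ≡⟨ %-absorbʳ _ _ ⟨
    (toℕ a + (toℕ b + toℕ c) % k) % k       ≡⟨ cong (λ z → (toℕ a + z) % k) (toℕ-mod _) ⟨
    (toℕ a + toℕ (b +C c)) % k              ≡⟨ toℕ-mod _ ⟨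
    toℕ (a +C (b +C c))                     ∎)

  +C-comm : ∀ (a b : Fin k) → a +C b ≡ b +C a
  +C-comm a b = cong (_mod k) (ℕₚ.+-comm (toℕ a) (toℕ b))

  +C-identityʳ : ∀ (a : Fin k) → a +C 0C ≡ a
  +C-identityʳ a = toℕ-injective (begin
    toℕ (a +C 0C)              ≡⟨ toℕ-mod _ ⟩
    (toℕ a + toℕ (0C {k})) % k ≡⟨ cong (λ z → (toℕ a + z) % k) toℕ-0C ⟩
    (toℕ a + 0) % k            ≡⟨ cong (_% k) (ℕₚ.+-identityʳ (toℕ a)) ⟩
    toℕ a % k                  ≡⟨ m<n⇒m%n≡m (toℕ<n a) ⟩
    toℕ a                      ∎)

  +C-inverseʳ : ∀ (a : Fin k) → a +C (-C a) ≡ 0C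
  +C-inverseʳ a = toℕ-injective (begin
    toℕ (a +C (-C a))                 ≡⟨ toℕ-mod _ ⟩
    (toℕ a + toℕ (-C a)) % k          ≡⟨ cong (λ z → (toℕ a + z) % k) (toℕ-mod _) ⟩
    (toℕ a + (k ℕ.∸ toℕ a) % k) % k   ≡⟨ %-absorbʳ _ _ ⟩
    (toℕ a + (k ℕ.∸ toℕ a)) % k       ≡⟨ cong (_% k) (ℕₚ.m+[n∸m]≡n (toℕ≤n a)) ⟩
    k % k                             ≡⟨ n%n≡0 k ⟩
    0                                 ≡⟨ toℕ-0C ⟨
    toℕ (0C {k})                      ∎)

  isAbelianGroup : IsAbelianGroup _≡_ _+C_ 0C -C_
  isAbelianGroup = record
    { isGroup = record
      { isMonoid = record
        { isSemigroup = record
          { isMagma = record { isEquivalence = ≡.isEquivalence ; ∙-cong = cong₂ _+C_ }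
          ; assoc = +C-assoc
          }
        ; identity = (λ a → ≡.trans (+C-comm 0C a) (+C-identityʳ a)) , +C-identityʳ
        }
      ; inverse = (λ a → ≡.trans (+C-comm (-C a) a) (+C-inverseʳ a)) , +C-inverseʳ
      ; ⁻¹-cong = cong -C_
      }
    ; comm = +C-comm
    }

  abelianGroup : AbelianGroup _ _
  abelianGroup = record { isAbelianGroup = isAbelianGroup }

module CyclicGroupLaws {k : ℕ} .{{_ : NonZero k}} where
  open AbelianGroup (CyclicGroup.abelianGroup {k}) using (_∙_; _⁻¹; ε; assoc; comm; identityʳ)
  open import Algebra.Properties.AbelianGroup (CyclicGroup.abelianGroup {k}) using (⁻¹-∙-comm; ε⁻¹≈ε)
  open ≡.≡-Reasoning

  sub-sub : ∀ (h x y : Fin k) → (h ∙ y ⁻¹) ∙ x ⁻¹ ≡ h ∙ (x ∙ y) ⁻¹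
  sub-sub h x y = begin
    (h ∙ y ⁻¹) ∙ x ⁻¹   ≡⟨ assoc h (y ⁻¹) (x ⁻¹) ⟩
    h ∙ (y ⁻¹ ∙ x ⁻¹)   ≡⟨ cong (h ∙_) (⁻¹-∙-comm y x) ⟩
    h ∙ (y ∙ x) ⁻¹      ≡⟨ cong (λ z → h ∙ z ⁻¹) (comm y x) ⟩
    h ∙ (x ∙ y) ⁻¹      ∎

  sub-ε : ∀ (h : Fin k) → h ∙ ε ⁻¹ ≡ h
  sub-ε h = ≡.trans (cong (h ∙_) ε⁻¹≈ε) (identityʳ h)

module GroupLaws (m n : ℕ) .{{_ : NonZero m}} .{{_ : NonZero (m ℕ.* n)}} where
  open CyclicGroupLaws

  infixl 6 _⊖_
  _⊖_ : G m n → G m n → G m n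
  h ⊖ g = _+G_ m n h (-G_ m n g)

  ⊖-⊖ : ∀ h x y → (h ⊖ y) ⊖ x ≡ h ⊖ (_+G_ m n x y)
  ⊖-⊖ (h₁ , h₂) (x₁ , x₂) (y₁ , y₂) = cong₂ _,_ (sub-sub h₁ x₁ y₁) (sub-sub h₂ x₂ y₂)

  ⊖-0G : ∀ h → h ⊖ 0G m n ≡ h
  ⊖-0G (h₁ , h₂) = cong₂ _,_ (sub-ε h₁) (sub-ε h₂)

  +G-comm : ∀ x y → _+G_ m n x y ≡ _+G_ m n y x
  +G-comm (x₁ , x₂) (y₁ , y₂) = cong₂ _,_ (CyclicGroup.+C-comm x₁ y₁) (CyclicGroup.+C-comm x₂ y₂)

  ⊖-comm : ∀ h x y → (h ⊖ x) ⊖ y ≡ (h ⊖ y) ⊖ x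
  ⊖-comm h x y = begin
    (h ⊖ x) ⊖ y           ≡⟨ ⊖-⊖ h y x ⟩
    h ⊖ _+G_ m n y x      ≡⟨ cong (h ⊖_) (+G-comm y x) ⟩
    h ⊖ _+G_ m n x y      ≡⟨ ⊖-⊖ h x y ⟨
    (h ⊖ y) ⊖ x           ∎
    where open ≡.≡-Reasoning

module FiniteSums {c ℓ : Level} (A : AbelianGroup c ℓ) where
  open AbelianGroup A renaming
    (_∙_ to _+_; ε to 0#; _⁻¹ to -_; ∙-cong to +-cong; identityʳ to +-identityʳ; inverseʳ to -‿inverseʳ)
  open import Algebra.Properties.CommutativeMonoid.Sum commutativeMonoid public
    using (sum; sum-cong-≋)
  open import Algebra.Properties.CommutativeMonoid.Sum commutativeMonoid
    using (∑-distrib-+; sum-remove; sum-replicate-zero)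
  open import Algebra.Properties.AbelianGroup A using (inverseʳ-unique)
  open import Relation.Binary.Reasoning.Setoid setoid

  sum-zero : ∀ {j} (f : Vector Carrier j) → (∀ i → f i ≈ 0#) → sum f ≈ 0#
  sum-zero {j} f f≈0 = trans (sum-cong-≋ f≈0) (sum-replicate-zero j)

  sum-negate : ∀ {j} (f : Vector Carrier j) → sum (λ i → - f i) ≈ - sum f
  sum-negate f = inverseʳ-unique (sum f) _ (begin
    sum f + sum (λ i → - f i)  ≈⟨ ∑-distrib-+ f _ ⟨
    sum (λ i → f i + - f i)    ≈⟨ sum-zero _ (λ i → -‿inverseʳ (f i)) ⟩
    0#                         ∎)

  sum-distrib-- : ∀ {j} (f f' : Vector Carrier j) → sum (λ i → f i - f' i) ≈ sum f - sum f'
  sum-distrib-- f f' = trans (∑-distrib-+ f _) (+-cong refl (sum-negate f'))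

  sum-sift : ∀ {j} (f : Vector Carrier j) i → (∀ i' → i' ≢ i → f i' ≈ 0#) → sum f ≈ f i
  sum-sift {suc j} f i off = begin
    sum f                     ≈⟨ sum-remove {i = i} f ⟩
    f i + sum (removeAt f i)  ≈⟨ +-cong refl (sum-zero _ (λ i' → off (Fin.punchIn i i') (punchInᵢ≢i i i'))) ⟩
    f i + 0#                  ≈⟨ +-identityʳ _ ⟩
    f i                       ∎

module GroupAlgebraOperators {c ℓ : Level} (R : CommutativeRing c ℓ)
                             (m n : ℕ) .{{_ : NonZero m}} .{{_ : NonZero (m ℕ.* n)}} where
  open CommutativeRing R
  open GroupAlgebra R m n
  open GroupLaws m n
  open FiniteSums +-abelianGroup using (sum; sum-cong-≋; sum-zero; sum-distrib--; sum-sift)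
  open import Algebra.Properties.AbelianGroup +-abelianGroup
    using (//-cong₂; //-rightDividesˡ; ⁻¹-∙-comm)
  open import Algebra.Properties.Ring ring using (-‿distribˡ-*; -‿distribʳ-*)
  open import Algebra.Properties.CommutativeSemigroup +-commutativeSemigroup
    using () renaming (interchange to +-interchange)
  open import Algebra.Properties.CommutativeSemigroup *-commutativeSemigroup
    using () renaming (x∙yz≈y∙xz to *-x∙yz≈y∙xz)
  open import Relation.Binary.Reasoning.Setoid setoid

  sumFin≈sum : ∀ j (f : Fin j → Carrier) → sumFin j f ≈ sum f
  sumFin≈sum zero    f = refl
  sumFin≈sum (suc j) f = +-cong refl (sumFin≈sum j (f ∘ Fin.suc))

  sumG≈∑∑ : ∀ (f : G m n → Carrier) → sumG f ≈ sum (λ i → sum (λ j → f (i , j)))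
  sumG≈∑∑ f = trans (sumFin≈sum m _) (sum-cong-≋ (λ i → sumFin≈sum (m ℕ.* n) (λ j → f (i , j))))

  sumG-cong : ∀ {f f' : G m n → Carrier} → (∀ x → f x ≈ f' x) → sumG f ≈ sumG f'
  sumG-cong {f} {f'} f≈f' = begin
    sumG f                                ≈⟨ sumG≈∑∑ f ⟩
    sum (λ i → sum (λ j → f (i , j)))     ≈⟨ sum-cong-≋ (λ i → sum-cong-≋ (λ j → f≈f' (i , j))) ⟩
    sum (λ i → sum (λ j → f' (i , j)))    ≈⟨ sumG≈∑∑ f' ⟨
    sumG f'                               ∎

  sumG-distrib-- : ∀ (f f' : G m n → Carrier) → sumG (λ x → f x - f' x) ≈ sumG f - sumG f'
  sumG-distrib-- f f' = begin
    sumG (λ x → f x - f' x)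
      ≈⟨ sumG≈∑∑ (λ x → f x - f' x) ⟩
    sum (λ i → sum (λ j → f (i , j) - f' (i , j)))
      ≈⟨ sum-cong-≋ (λ i → sum-distrib-- (λ j → f (i , j)) (λ j → f' (i , j))) ⟩
    sum (λ i → sum (λ j → f (i , j)) - sum (λ j → f' (i , j)))
      ≈⟨ sum-distrib-- (λ i → sum (λ j → f (i , j))) _ ⟩
    sum (λ i → sum (λ j → f (i , j))) - sum (λ i → sum (λ j → f' (i , j)))
      ≈⟨ //-cong₂ (sumG≈∑∑ f) (sumG≈∑∑ f') ⟨
    sumG f - sumG f'
      ∎

  sumG-sift : ∀ (f : G m n → Carrier) p → (∀ x → x ≢ p → f x ≈ 0#) → sumG f ≈ f p
  sumG-sift f (i₀ , j₀) off = begin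
    sumG f                              ≈⟨ sumG≈∑∑ f ⟩
    sum (λ i → sum (λ j → f (i , j)))   ≈⟨ sum-sift _ i₀ (λ i i≢i₀ → sum-zero _ (λ j → off (i , j) (i≢i₀ ∘ cong proj₁))) ⟩
    sum (λ j → f (i₀ , j))              ≈⟨ sum-sift _ j₀ (λ j j≢j₀ → off (i₀ , j) (j≢j₀ ∘ cong proj₂)) ⟩
    f (i₀ , j₀)                         ∎

  *-sub-distribˡ : ∀ a y z → a * (y - z) ≈ a * y - a * z
  *-sub-distribˡ a y z = trans (distribˡ a y (- z)) (+-cong refl (sym (-‿distribʳ-* a z)))

  *-sub-distribʳ : ∀ u v w → (u - v) * w ≈ u * w - v * w
  *-sub-distribʳ u v w = trans (distribʳ w u (- v)) (+-cong refl (sym (-‿distribˡ-* v w)))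

  sub-+-interchange : ∀ p q r s a → (p + q) - a * (r + s) ≈ (p - a * r) + (q - a * s)
  sub-+-interchange p q r s a = begin
    (p + q) - a * (r + s)              ≈⟨ //-cong₂ refl (distribˡ a r s) ⟩
    (p + q) - (a * r + a * s)          ≈⟨ +-cong refl (⁻¹-∙-comm (a * r) (a * s)) ⟨
    (p + q) + (- (a * r) + - (a * s))  ≈⟨ +-interchange p q (- (a * r)) (- (a * s)) ⟩
    (p - a * r) + (q - a * s)          ∎

  sub-*-pull : ∀ b p a r → b * p - a * (b * r) ≈ b * (p - a * r)
  sub-*-pull b p a r = begin
    b * p - a * (b * r)   ≈⟨ //-cong₂ refl (*-x∙yz≈y∙xz a b r) ⟩
    b * p - b * (a * r)   ≈⟨ *-sub-distribˡ b p (a * r) ⟨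
    b * (p - a * r)       ∎

  -- The telescoping step behind  X^{(k+1)g} - a^{k+1} = (X^g - a) X^{kg} + a (X^{kg} - a^k).
  telescope : ∀ x y z a p → (x - a * y) + a * (y - p * z) ≈ x - (a * p) * z
  telescope x y z a p = begin
    (x - a * y) + a * (y - p * z)          ≈⟨ +-cong refl (*-sub-distribˡ a y (p * z)) ⟩
    (x - a * y) + (a * y - a * (p * z))    ≈⟨ +-assoc _ _ _ ⟨
    ((x - a * y) + a * y) - a * (p * z)    ≈⟨ +-cong (//-rightDividesˡ (a * y) x) refl ⟩
    x - a * (p * z)                        ≈⟨ //-cong₂ refl (*-assoc a p z) ⟨
    x - (a * p) * z                        ∎

  mono-at : ∀ a p → mono a p p ≈ a
  mono-at a p with _≟G_ m n p p
  ... | yes _  = refl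
  ... | no p≢p = ⊥-elim (p≢p ≡.refl)

  mono-off : ∀ a p x → x ≢ p → mono a p x ≈ 0#
  mono-off a p x x≢p with _≟G_ m n x p
  ... | yes x≡p = ⊥-elim (x≢p x≡p)
  ... | no _    = refl

  mono-sift : ∀ a p (φ : G m n → Carrier) → sumG (λ x → mono a p x * φ x) ≈ a * φ p
  mono-sift a p φ = begin
    sumG (λ x → mono a p x * φ x)  ≈⟨ sumG-sift _ p (λ x x≢p → trans (*-cong (mono-off a p x x≢p) refl) (zeroˡ _)) ⟩
    mono a p p * φ p               ≈⟨ *-cong (mono-at a p) refl ⟩
    a * φ p                        ∎

  -- Elements of R[G] as coefficient functions: pointwise sum, scalar multiple,
  -- translation  translate g f = X^g f  and  binom g a f = (X^g - a) f.
  infixl 6 _+R_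
  _+R_ : RG → RG → RG
  (f +R f') h = f h + f' h

  infixr 7 _·_
  _·_ : Carrier → RG → RG
  (a · f) h = a * f h

  RG-setoid : Setoid c ℓ
  RG-setoid = ≡-setoid (G m n) (Trivial.indexedSetoid setoid)

  module ≈R = Setoid RG-setoid

  translate : G m n → RG → RG
  translate g f h = f (h ⊖ g)

  binom : G m n → Carrier → RG → RG
  binom g a f = translate g f -R a · f

  binom-mult : ∀ g a f → ((X^ g -R emb a) *R f) ≈R binom g a f
  binom-mult g a f h = begin
    sumG (λ x → (mono 1# g x - mono a 0ᴳ x) * f (h ⊖ x))
      ≈⟨ sumG-cong (λ x → *-sub-distribʳ (mono 1# g x) (mono a 0ᴳ x) (f (h ⊖ x))) ⟩
    sumG (λ x → mono 1# g x * f (h ⊖ x) - mono a 0ᴳ x * f (h ⊖ x))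
      ≈⟨ sumG-distrib-- _ _ ⟩
    sumG (λ x → mono 1# g x * f (h ⊖ x)) - sumG (λ x → mono a 0ᴳ x * f (h ⊖ x))
      ≈⟨ //-cong₂ (mono-sift 1# g _) (mono-sift a 0ᴳ _) ⟩
    1# * f (h ⊖ g) - a * f (h ⊖ 0ᴳ)
      ≈⟨ //-cong₂ (*-identityˡ _) (*-cong refl (reflexive (cong f (⊖-0G h)))) ⟩
    f (h ⊖ g) - a * f h ∎
    where
      0ᴳ : G m n
      0ᴳ = 0G m n

  -- An operator on R[G] behaving like multiplication by a fixed element:
  -- it respects equality, is R-linear and commutes with all translations.
  record Equivariant (O : RG → RG) : Set (c ⊔ ℓ) where
    field
      cong-≈R        : ∀ {f f'} → f ≈R f' → O f ≈R O f'
      additive       : ∀ f f' → O (f +R f') ≈R (O f +R O f')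
      homogeneous    : ∀ a f → O (a · f) ≈R (a · O f)
      translate-comm : ∀ g f → O (translate g f) ≈R translate g (O f)
  open Equivariant

  Equivariant-0R : ∀ {O} → Equivariant O → O 0R ≈R 0R
  Equivariant-0R {O} eq h = begin
    O 0R h         ≈⟨ cong-≈R eq (λ _ → sym (zeroˡ 0#)) h ⟩
    O (0# · 0R) h  ≈⟨ homogeneous eq 0# 0R h ⟩
    0# * O 0R h    ≈⟨ zeroˡ _ ⟩
    0#             ∎

  -- Multiplication by X^g - a is equivariant; translations commute because G is abelian.
  binom-equivariant : ∀ g a → Equivariant (binom g a)
  binom-equivariant g a = record
    { cong-≈R        = λ f≈f' h → //-cong₂ (f≈f' _) (*-cong refl (f≈f' h))
    ; additive       = λ f f' h → sub-+-interchange _ _ _ _ a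
    ; homogeneous    = λ b f h → sub-*-pull b _ a _
    ; translate-comm = λ g' f h → reflexive (cong (λ x → f x - a * f (h ⊖ g')) (⊖-comm h g g'))
    }

  -- geom g a k is multiplication by  Σ_{j<k} a^{k-1-j} X^{jg},  the cofactor in
  -- X^{kg} - a^k = (X^g - a) Σ_{j<k} a^{k-1-j} X^{jg}.
  geom : G m n → Carrier → ℕ → RG → RG
  geom g a zero    f = 0R
  geom g a (suc k) f = translate (_•G_ m n k g) f +R a · geom g a k f

  geom-cong : ∀ g a k {f f'} → f ≈R f' → geom g a k f ≈R geom g a k f'
  geom-cong g a zero    f≈f' = ≈R.refl
  geom-cong g a (suc k) f≈f' h = +-cong (f≈f' _) (*-cong refl (geom-cong g a k f≈f' h))

  geom-0R : ∀ g a k → geom g a k 0R ≈R 0R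
  geom-0R g a zero    = ≈R.refl
  geom-0R g a (suc k) h = trans (+-identityˡ _) (trans (*-cong refl (geom-0R g a k h)) (zeroʳ a))

  geom-comm : ∀ {O} → Equivariant O → ∀ g a k f → O (geom g a k f) ≈R geom g a k (O f)
  geom-comm eq g a zero    f = Equivariant-0R eq
  geom-comm {O} eq g a (suc k) f h = begin
    O (translate kg f +R a · geom g a k f) h          ≈⟨ additive eq (translate kg f) (a · geom g a k f) h ⟩
    O (translate kg f) h + O (a · geom g a k f) h     ≈⟨ +-cong (translate-comm eq kg f h) (homogeneous eq a (geom g a k f) h) ⟩
    O f (h ⊖ kg) + a * O (geom g a k f) h             ≈⟨ +-cong refl (*-cong refl (geom-comm eq g a k f h)) ⟩
    O f (h ⊖ kg) + a * geom g a k (O f) h             ∎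
    where
      kg : G m n
      kg = _•G_ m n k g

  binom-geom : ∀ g a k f → binom g a (geom g a k f) ≈R binom (_•G_ m n k g) (pow a k) f
  binom-geom g a zero f h = begin
    0# - a * 0#             ≈⟨ trans (//-cong₂ refl (zeroʳ a)) (-‿inverseʳ 0#) ⟩
    0#                      ≈⟨ trans (//-cong₂ refl (*-identityˡ (f h))) (-‿inverseʳ (f h)) ⟨
    f h - 1# * f h          ≈⟨ //-cong₂ (reflexive (cong f (⊖-0G h))) refl ⟨
    f (h ⊖ 0G m n) - 1# * f h ∎
  binom-geom g a (suc k) f h = begin
    binom g a (translate kg f +R a · geom g a k f) h
      ≈⟨ additive bg (translate kg f) (a · geom g a k f) h ⟩
    binom g a (translate kg f) h + binom g a (a · geom g a k f) h
      ≈⟨ +-cong refl (homogeneous bg a (geom g a k f) h) ⟩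
    (f ((h ⊖ g) ⊖ kg) - a * f (h ⊖ kg)) + a * binom g a (geom g a k f) h
      ≈⟨ +-cong refl (*-cong refl (binom-geom g a k f h)) ⟩
    (f ((h ⊖ g) ⊖ kg) - a * f (h ⊖ kg)) + a * (f (h ⊖ kg) - pow a k * f h)
      ≈⟨ telescope _ _ _ a (pow a k) ⟩
    f ((h ⊖ g) ⊖ kg) - (a * pow a k) * f h
      ≈⟨ //-cong₂ (reflexive (cong f shift-twice)) refl ⟩
    f (h ⊖ _•G_ m n (suc k) g) - pow a (suc k) * f h ∎
    where
      kg : G m n
      kg = _•G_ m n k g
      bg : Equivariant (binom g a)
      bg = binom-equivariant g a
      shift-twice : (h ⊖ g) ⊖ kg ≡ h ⊖ _•G_ m n (suc k) g
      shift-twice = ≡.trans (⊖-comm h g kg) (⊖-⊖ h g kg)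

  binoms : ∀ l → (Fin l → G m n) → (Fin l → Carrier) → RG → RG
  binoms zero    g a f = f
  binoms (suc l) g a f = binom (head g) (head a) (binoms l (tail g) (tail a) f)

  geoms : ∀ l → (Fin l → G m n) → (Fin l → Carrier) → (Fin l → ℕ) → RG → RG
  geoms zero    g a k f = f
  geoms (suc l) g a k f = geom (head g) (head a) (head k) (geoms l (tail g) (tail a) (tail k) f)

  geoms-cong : ∀ l g a k {f f'} → f ≈R f' → geoms l g a k f ≈R geoms l g a k f'
  geoms-cong zero    g a k f≈f' = f≈f'
  geoms-cong (suc l) g a k f≈f' =
    geom-cong (head g) (head a) (head k) (geoms-cong l (tail g) (tail a) (tail k) f≈f')

  geoms-0R : ∀ l g a k → geoms l g a k 0R ≈R 0R
  geoms-0R zero    g a k = ≈R.refl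
  geoms-0R (suc l) g a k = ≈R.trans
    (geom-cong (head g) (head a) (head k) (geoms-0R l (tail g) (tail a) (tail k)))
    (geom-0R (head g) (head a) (head k))

  geoms-comm : ∀ {O} → Equivariant O → ∀ l g a k f → O (geoms l g a k f) ≈R geoms l g a k (O f)
  geoms-comm eq zero    g a k f = ≈R.refl
  geoms-comm eq (suc l) g a k f = ≈R.trans
    (geom-comm eq (head g) (head a) (head k) (geoms l (tail g) (tail a) (tail k) f))
    (geom-cong (head g) (head a) (head k) (geoms-comm eq l (tail g) (tail a) (tail k) f))

  prodR-binoms : ∀ l g a → prodR l (λ i → X^ g i -R emb (a i)) ≈R binoms l g a 1R
  prodR-binoms zero    g a = ≈R.refl
  prodR-binoms (suc l) g a h = trans
    (sumG-cong (λ x → *-cong refl (prodR-binoms l (tail g) (tail a) _)))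
    (binom-mult (head g) (head a) (binoms l (tail g) (tail a) 1R) h)

  binoms-powers : ∀ l g a k f →
    binoms l (λ i → _•G_ m n (k i) (g i)) (λ i → pow (a i) (k i)) f ≈R geoms l g a k (binoms l g a f)
  binoms-powers zero    g a k f = ≈R.refl
  binoms-powers (suc l) g a k f h = begin
    binom (k₀•g₀) (pow a₀ k₀) (binoms l _ _ f) h
      ≈⟨ cong-≈R (binom-equivariant (k₀•g₀) (pow a₀ k₀)) (binoms-powers l g' a' k' f) h ⟩
    binom (k₀•g₀) (pow a₀ k₀) (geoms l g' a' k' (binoms l g' a' f)) h
      ≈⟨ binom-geom g₀ a₀ k₀ _ h ⟨
    binom g₀ a₀ (geom g₀ a₀ k₀ (geoms l g' a' k' (binoms l g' a' f))) h
      ≈⟨ geom-comm (binom-equivariant g₀ a₀) g₀ a₀ k₀ _ h ⟩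
    geom g₀ a₀ k₀ (binom g₀ a₀ (geoms l g' a' k' (binoms l g' a' f))) h
      ≈⟨ geom-cong g₀ a₀ k₀ (geoms-comm (binom-equivariant g₀ a₀) l g' a' k' _) h ⟩
    geom g₀ a₀ k₀ (geoms l g' a' k' (binom g₀ a₀ (binoms l g' a' f))) h
      ∎
    where
      g₀ : G m n
      g₀ = head g
      a₀ : Carrier
      a₀ = head a
      k₀ : ℕ
      k₀ = head k
      k₀•g₀ : G m n
      k₀•g₀ = _•G_ m n k₀ g₀
      g' : Fin l → G m n
      g' = tail g
      a' : Fin l → Carrier
      a' = tail a
      k' : Fin l → ℕ
      k' = tail k

  binomial-powers-vanish : ∀ l g a (k : Fin l → ℕ) →
    prodR l (λ i → X^ g i -R emb (a i)) ≈R 0R →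
    prodR l (λ i → X^ (_•G_ m n (k i) (g i)) -R emb (pow (a i) (k i))) ≈R 0R
  binomial-powers-vanish l g a k prod≈0 h = begin
    prodR l (λ i → X^ (_•G_ m n (k i) (g i)) -R emb (pow (a i) (k i))) h
      ≈⟨ prodR-binoms l (λ i → _•G_ m n (k i) (g i)) (λ i → pow (a i) (k i)) h ⟩
    binoms l (λ i → _•G_ m n (k i) (g i)) (λ i → pow (a i) (k i)) 1R h
      ≈⟨ binoms-powers l g a k 1R h ⟩
    geoms l g a k (binoms l g a 1R) h
      ≈⟨ geoms-cong l g a k (≈R.trans (≈R.sym (prodR-binoms l g a)) prod≈0) h ⟩
    geoms l g a k 0R h
      ≈⟨ geoms-0R l g a k h ⟩
    0# ∎

open import Data.Nat using (_≤_; _+_)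

-- The statement specialised to m = 2 + m', n = suc n'.
lemma3p1 : {c ℓ : Level} (R : CommutativeRing c ℓ) (m' n' : ℕ) →
  ¬ (CommutativeRing._≈_ R (CommutativeRing.1# R) (CommutativeRing.0# R)) →
  (l : ℕ) (g : Fin l → G (2 + m') (suc n')) (a : Fin l → CommutativeRing.Carrier R) →
  (∀ i → ¬ (CommutativeRing._≈_ R (a i) (CommutativeRing.0# R))) →
  GroupAlgebra._≈R_ R (2 + m') (suc n')
    (GroupAlgebra.prodR R (2 + m') (suc n') l
      (λ i → GroupAlgebra._-R_ R (2 + m') (suc n')
               (GroupAlgebra.X^_ R (2 + m') (suc n') (g i))
               (GroupAlgebra.emb R (2 + m') (suc n') (a i))))
    (GroupAlgebra.0R R (2 + m') (suc n')) →
  (k : Fin l → ℕ) → (∀ i → 1 ≤ k i) →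
  GroupAlgebra._≈R_ R (2 + m') (suc n')
    (GroupAlgebra.prodR R (2 + m') (suc n') l
      (λ i → GroupAlgebra._-R_ R (2 + m') (suc n')
               (GroupAlgebra.X^_ R (2 + m') (suc n') (_•G_ (2 + m') (suc n') (k i) (g i)))
               (GroupAlgebra.emb R (2 + m') (suc n') (GroupAlgebra.pow R (2 + m') (suc n') (a i) (k i)))))
    (GroupAlgebra.0R R (2 + m') (suc n'))
lemma3p1 R m' n' _ l g a _ prod≈0 k _ =
  GroupAlgebraOperators.binomial-powers-vanish R (2 + m') (suc n') l g a k prod≈0
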